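{- Let $\mu$ be a partition with at most $n$ parts and $\mathrm{rev}(\mu)=(\mu_n,\dots,\mu_1)$. A subset of $\mathbb D(\mathrm{rev}(\mu))$ is a snake of $\mathrm{rev}(\mu)$ if and only if it is a rim hook of $\mu$.
   Context: Cells $(c,r)$: column $c$, row $r$, row 1 at the bottom. For $\mathbf b\in\mathbb N^n$, $\mathbb D(\mathbf b)=\{(c,r)\in\mathbb Z_{>0}\times[n]:c\le\mathbf b_r\}$ (so $\mathbb D(\mathrm{rev}(\mu))$ is the Ferrers diagram of $\mu$ in English convention). Young's lattice: for partitions with at most $n$ parts, $\lambda\preceq_Y\mu$ iff $\lambda_i\le\mu_i$ for all $i$. Two cells are connected if horizontally or vertically adjacent; a set is connected if it forms a single class under the transitive closure of this relation. A rim hook of $\mu$ is $R\subseteq\mathbb D(\mathrm{rev}(\mu))$ with (1) $R$ connected, (2) $\mathbb D(\mathrm{rev}(\mu))\setminus R=\mathbb D(\mathrm{rev}(\lambda))$ for some partition $\lambda\preceq_Y\mu$, (3) $R$ contains no four cells $(c,r),(c+1,r),(c,r+1),(c+1,r+1)$. Key poset on $\mathbb N^n$: $\mathbf a\preceq\mathbf b$ iff $\mathbf a_i\le\mathbf b_i$ for all $i$, and $\mathbf a_i>\mathbf a_j$ with $i<j$ implies $\mathbf b_i>\mathbf b_j$. Two cells are weakly connected if they share a column or lie in adjacent columns with the left cell weakly higher; a set is weakly connected if it forms a single class under the transitive closure. A snake of $\mathbf b$ is $S\subseteq\mathbb D(\mathbf b)$ with (1) $S$ weakly connected, (2) $\mathbb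 D(\mathbf b)\setminus S=\mathbb D(\mathbf a)$ for some $\mathbf a\preceq\mathbf b$, (3) $S$ contains no three cells $(c,s),(c+1,s),(c+1,r)$ with $r<s$. -}

module Defs where

open import Data.Nat using (ℕ; suc; _≤_; _<_)
open import Data.Fin as Fin using (Fin; toℕ)
open import Data.Vec using (Vec; lookup; reverse)
open import Data.Bool using (Bool; true; false)
open import Data.Product using (_×_; Σ; ∃; ∃-syntax; proj₁; proj₂; _,_)
open import Data.Sum using (_⊎_)
open import Relation.Binary.PropositionalEquality using (_≡_)
open import Relation.Binary.Construct.Closure.ReflexiveTransitive using (Star)
open import Relation.Nullary using (¬_)
open import Function.Bundles using (_⇔_)

-- A cell (c , r): column c (a positive integer, enforced by InD), row r.
-- Row r ∈ [n] is represented by Fin n, with row 1 (bottom) = Fin.zero,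
-- i.e. the row number is toℕ r + 1.
Cell : ℕ → Set
Cell n = ℕ × Fin n

col : ∀ {n} → Cell n → ℕ
col = proj₁

row : ∀ {n} → Cell n → ℕ
row x = toℕ (proj₂ x)

CellSet : ℕ → Set
CellSet n = Cell n → Bool

_∈_ : ∀ {n} → Cell n → CellSet n → Set
x ∈ S = S x ≡ true

InD : ∀ {n} → Vec ℕ n → Cell n → Set
InD b (c , r) = 1 ≤ c × c ≤ lookup b r

_⊆D_ : ∀ {n} → CellSet n → Vec ℕ n → Set
S ⊆D b = ∀ x → x ∈ S → InD b x

ComplementIs : ∀ {n} → Vec ℕ n → CellSet n → Vec ℕ n → Set
ComplementIs b S a = ∀ x → ((InD b x × ¬ (x ∈ S)) ⇔ InD a x)

-- Partition with at most n parts, stored as (μ_1, …, μ_n), weakly decreasing.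
IsPartition : ∀ {n} → Vec ℕ n → Set
IsPartition μ = ∀ i j → i Fin.≤ j → lookup μ j ≤ lookup μ i

_≼Y_ : ∀ {n} → Vec ℕ n → Vec ℕ n → Set
λ' ≼Y μ = ∀ i → lookup λ' i ≤ lookup μ i

_≼K_ : ∀ {n} → Vec ℕ n → Vec ℕ n → Set
a ≼K b = (∀ i → lookup a i ≤ lookup b i)
       × (∀ i j → i Fin.< j → lookup a j < lookup a i → lookup b j < lookup b i)

Connected : ∀ {n} → (Cell n → Cell n → Set) → CellSet n → Set
Connected {n} Adj S =
  (∃[ x ] x ∈ S) ×
  (∀ x y → x ∈ S → y ∈ S → Star (λ u v → u ∈ S × v ∈ S × Adj u v) x y)

Adjacent : ∀ {n} → Cell n → Cell n → Set
Adjacent x y =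
    (row x ≡ row y × suc (col x) ≡ col y)
  ⊎ (row x ≡ row y × suc (col y) ≡ col x)
  ⊎ (col x ≡ col y × suc (row x) ≡ row y)
  ⊎ (col x ≡ col y × suc (row y) ≡ row x)

-- Weak adjacency: same column, or adjacent columns with the left cell
-- weakly higher (symmetrised, as it is a relation on unordered pairs).
WeakAdjacent : ∀ {n} → Cell n → Cell n → Set
WeakAdjacent x y =
    (col x ≡ col y)
  ⊎ (suc (col x) ≡ col y × row y ≤ row x)
  ⊎ (suc (col y) ≡ col x × row x ≤ row y)

IsRimHook : ∀ {n} → Vec ℕ n → CellSet n → Set
IsRimHook {n} μ R =
  R ⊆D reverse μ
  × Connected Adjacent R
  × (∃[ λ' ] (IsPartition λ' × λ' ≼Y μ × ComplementIs (reverse μ) R (reverse λ')))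
  × (∀ c (r r' : Fin n) → suc (toℕ r) ≡ toℕ r' →
       ¬ ((c , r) ∈ R × (suc c , r) ∈ R × (c , r') ∈ R × (suc c , r') ∈ R))

IsSnake : ∀ {n} → Vec ℕ n → CellSet n → Set
IsSnake {n} b S =
  S ⊆D b
  × Connected WeakAdjacent S
  × (∃[ a ] (a ≼K b × ComplementIs b S a))
  × (∀ c (r s : Fin n) → r Fin.< s →
       ¬ ((c , s) ∈ S × (suc c , s) ∈ S × (suc c , r) ∈ S))

-- Reversing μ turns a partition into a weakly increasing vector b, and for increasing b the key
-- order below b coincides with the Young order, so in both notions S is a skew shape
-- 𝔻(b) ∖ 𝔻(a) with a, b increasing. Such a shape meets every column in an interval of rows,
-- and every cell lying between two of its cells (weakly below and left of one, weakly above
-- and right of the other) belongs to it. This convexity turns each weak adjacency into a path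
-- of ordinary adjacencies, and completes a forbidden elbow (c,s), (c+1,s), (c+1,r), r < s,
-- to a forbidden 2×2 square in rows s−1 and s.
module Submission where

open import Defs
open import Data.Nat using (ℕ; zero; suc; _+_; _≤_; _<_; _∸_; s≤s; _≤?_; _<?_)
open import Data.Nat.Properties
open import Data.Fin as Fin using (Fin; toℕ; fromℕ; inject₁; opposite)
open import Data.Fin.Properties using (toℕ-injective; toℕ-inject₁; opposite-prop; opposite-involutive)
open import Data.Vec using (Vec; _∷_; []; _∷ʳ_; lookup; reverse)
open import Data.Vec.Properties using (reverse-∷; reverse-involutive)
open import Data.Bool using (true; false)
open import Data.Product using (_×_; Σ-syntax; proj₁; proj₂; _,_)
open import Data.Sum using (inj₁; inj₂)
open import Data.Empty using (⊥-elim)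
open import Relation.Binary.PropositionalEquality
open import Relation.Binary.Construct.Closure.ReflexiveTransitive as Star using (Star; ε; _◅_; _◅◅_; _⋆)
open import Relation.Nullary using (¬_; yes; no)
open import Function.Base using (case_of_)
open import Function.Bundles using (_⇔_; Equivalence; mk⇔)

lookup-∷ʳ-fromℕ : ∀ {A : Set} {n} (xs : Vec A n) x → lookup (xs ∷ʳ x) (fromℕ n) ≡ x
lookup-∷ʳ-fromℕ []       x = refl
lookup-∷ʳ-fromℕ (_ ∷ xs) x = lookup-∷ʳ-fromℕ xs x

lookup-∷ʳ-inject₁ : ∀ {A : Set} {n} (xs : Vec A n) x i → lookup (xs ∷ʳ x) (inject₁ i) ≡ lookup xs i
lookup-∷ʳ-inject₁ (_ ∷ xs) x Fin.zero    = refl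
lookup-∷ʳ-inject₁ (_ ∷ xs) x (Fin.suc i) = lookup-∷ʳ-inject₁ xs x i

lookup-reverse-opposite : ∀ {A : Set} {n} (xs : Vec A n) i → lookup (reverse xs) (opposite i) ≡ lookup xs i
lookup-reverse-opposite (x ∷ xs) Fin.zero rewrite reverse-∷ x xs = lookup-∷ʳ-fromℕ (reverse xs) x
lookup-reverse-opposite (x ∷ xs) (Fin.suc i) rewrite reverse-∷ x xs =
  trans (lookup-∷ʳ-inject₁ (reverse xs) x (opposite i)) (lookup-reverse-opposite xs i)

lookup-reverse : ∀ {A : Set} {n} (xs : Vec A n) i → lookup (reverse xs) i ≡ lookup xs (opposite i)
lookup-reverse xs i = begin
  lookup (reverse xs) i                       ≡⟨ cong (lookup (reverse xs)) (opposite-involutive i) ⟨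
  lookup (reverse xs) (opposite (opposite i)) ≡⟨ lookup-reverse-opposite xs (opposite i) ⟩
  lookup xs (opposite i)                      ∎
  where open ≡-Reasoning

opposite-antitone : ∀ {n} {i j : Fin n} → i Fin.≤ j → opposite j Fin.≤ opposite i
opposite-antitone {n} {i} {j} i≤j rewrite opposite-prop i | opposite-prop j = ∸-monoʳ-≤ n (s≤s i≤j)

row-below : ∀ {n} {r : Fin n} (s : Fin n) → r Fin.< s → Σ[ t ∈ Fin n ] r Fin.≤ t × suc (toℕ t) ≡ toℕ s
row-below {r = r} (Fin.suc i) (s≤s r≤i) =
  inject₁ i , subst (toℕ r ≤_) (sym (toℕ-inject₁ i)) r≤i , cong suc (toℕ-inject₁ i)

Ascending : ∀ {n} → Vec ℕ n → Set
Ascending b = ∀ i j → i Fin.≤ j → lookup b i ≤ lookup b j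

partition⇒reverse-ascending : ∀ {n} (μ : Vec ℕ n) → IsPartition μ → Ascending (reverse μ)
partition⇒reverse-ascending μ μ-part i j i≤j rewrite lookup-reverse μ i | lookup-reverse μ j =
  μ-part (opposite j) (opposite i) (opposite-antitone i≤j)

ascending⇒reverse-partition : ∀ {n} (a : Vec ℕ n) → Ascending a → IsPartition (reverse a)
ascending⇒reverse-partition a a-asc i j i≤j rewrite lookup-reverse a i | lookup-reverse a j =
  a-asc (opposite j) (opposite i) (opposite-antitone i≤j)

≼Y-reverse : ∀ {n} {a b : Vec ℕ n} → a ≼Y b → reverse a ≼Y reverse b
≼Y-reverse {a = a} {b} a≤b i rewrite lookup-reverse a i | lookup-reverse b i = a≤b (opposite i)

≼K⇒ascending : ∀ {n} {a b : Vec ℕ n} → Ascending b → a ≼K b → Ascending a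
≼K⇒ascending {a = a} {b} b-asc (_ , keep-descents) i j i≤j with m≤n⇒m<n∨m≡n i≤j
... | inj₂ i≡j rewrite toℕ-injective {i = i} {j = j} i≡j = ≤-refl
... | inj₁ i<j with lookup a j <? lookup a i
...   | yes descent = ⊥-elim (<⇒≱ (keep-descents i j i<j descent) (b-asc i j i≤j))
...   | no ¬descent = ≮⇒≥ ¬descent

ascending⇒≼K : ∀ {n} {a b : Vec ℕ n} → Ascending a → a ≼Y b → a ≼K b
ascending⇒≼K a-asc a≤b = a≤b , λ i j i<j descent → ⊥-elim (<⇒≱ descent (a-asc i j (<⇒≤ i<j)))

Link : ∀ {n} → (Cell n → Cell n → Set) → CellSet n → Cell n → Cell n → Set
Link R S u v = u ∈ S × v ∈ S × R u v

connected-via : ∀ {n} {R R′ : Cell n → Cell n → Set} {S : CellSet n} →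
  (∀ {x y} → Link R S x y → Star (Link R′ S) x y) → Connected R S → Connected R′ S
connected-via link⇒path (nonempty , paths) = nonempty , λ x y x∈ y∈ → (link⇒path ⋆) (paths x y x∈ y∈)

Adjacent-sym : ∀ {n} {x y : Cell n} → Adjacent x y → Adjacent y x
Adjacent-sym (inj₁ (r≡ , c≡))                = inj₂ (inj₁ (sym r≡ , c≡))
Adjacent-sym (inj₂ (inj₁ (r≡ , c≡)))         = inj₁ (sym r≡ , c≡)
Adjacent-sym (inj₂ (inj₂ (inj₁ (c≡ , r≡))))  = inj₂ (inj₂ (inj₂ (sym c≡ , r≡)))
Adjacent-sym (inj₂ (inj₂ (inj₂ (c≡ , r≡))))  = inj₂ (inj₂ (inj₁ (sym c≡ , r≡)))

Adjacent⇒WeakAdjacent : ∀ {n} {x y : Cell n} → Adjacent x y → WeakAdjacent x y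
Adjacent⇒WeakAdjacent (inj₁ (r≡ , c≡))               = inj₂ (inj₁ (c≡ , ≤-reflexive (sym r≡)))
Adjacent⇒WeakAdjacent (inj₂ (inj₁ (r≡ , c≡)))        = inj₂ (inj₂ (c≡ , ≤-reflexive r≡))
Adjacent⇒WeakAdjacent (inj₂ (inj₂ (inj₁ (c≡ , _))))  = inj₁ c≡
Adjacent⇒WeakAdjacent (inj₂ (inj₂ (inj₂ (c≡ , _))))  = inj₁ c≡

adjacent⇒weakly-connected : ∀ {n} {S : CellSet n} → Connected Adjacent S → Connected WeakAdjacent S
adjacent⇒weakly-connected = connected-via λ (x∈ , y∈ , adj) → Star.return (x∈ , y∈ , Adjacent⇒WeakAdjacent adj)

SquareFree : ∀ {n} → CellSet n → Set
SquareFree {n} S = ∀ c (r r′ : Fin n) → suc (toℕ r) ≡ toℕ r′ →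
  ¬ ((c , r) ∈ S × (suc c , r) ∈ S × (c , r′) ∈ S × (suc c , r′) ∈ S)

ElbowFree : ∀ {n} → CellSet n → Set
ElbowFree {n} S = ∀ c (r s : Fin n) → r Fin.< s →
  ¬ ((c , s) ∈ S × (suc c , s) ∈ S × (suc c , r) ∈ S)

elbowFree⇒squareFree : ∀ {n} {S : CellSet n} → ElbowFree S → SquareFree S
elbowFree⇒squareFree elbowFree c r r′ r+1≡r′ (_ , low-right , top-left , top-right) =
  elbowFree c r r′ (≤-reflexive r+1≡r′) (top-left , top-right , low-right)

module SkewShape {n : ℕ} (b a : Vec ℕ n) (S : CellSet n) (S⊆b : S ⊆D b)
  (S-skew : ComplementIs b S a) (a-asc : Ascending a) (b-asc : Ascending b) where

  InSkew : Cell n → Set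
  InSkew (c , r) = InD b (c , r) × lookup a r < c

  ∈⇒InSkew : ∀ {x} → x ∈ S → InSkew x
  ∈⇒InSkew {c , r} x∈ with c ≤? lookup a r
  ... | yes inA = ⊥-elim (proj₂ (Equivalence.from (S-skew (c , r)) (proj₁ (S⊆b (c , r) x∈) , inA)) x∈)
  ... | no ¬inA = S⊆b (c , r) x∈ , ≰⇒> ¬inA

  InSkew⇒∈ : ∀ {x} → InSkew x → x ∈ S
  InSkew⇒∈ {x} (inB , a<c) with S x in Sx
  ... | true  = refl
  ... | false = ⊥-elim (<⇒≱ a<c (proj₂ (Equivalence.to (S-skew x) (inB , λ x∈ → case trans (sym Sx) x∈ of λ ()))))

  ∈-convex : ∀ {c c₁ c₂} {r s t : Fin n} → (c₁ , r) ∈ S → (c₂ , s) ∈ S →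
    r Fin.≤ t → t Fin.≤ s → c₂ ≤ c → c ≤ c₁ → (c , t) ∈ S
  ∈-convex {r = r} {s} {t} x∈ y∈ r≤t t≤s c₂≤c c≤c₁ =
    let (_ , c₁≤b) , _ = ∈⇒InSkew x∈
        (1≤c₂ , _) , a<c₂ = ∈⇒InSkew y∈
    in  InSkew⇒∈ ( (≤-trans 1≤c₂ c₂≤c , ≤-trans c≤c₁ (≤-trans c₁≤b (b-asc r t r≤t)))
                 , <-≤-trans (≤-<-trans (a-asc t s t≤s) a<c₂) c₂≤c)

  Step : Cell n → Cell n → Set
  Step = Link Adjacent S

  Step-sym : ∀ {x y} → Step x y → Step y x
  Step-sym (x∈ , y∈ , adj) = y∈ , x∈ , Adjacent-sym adj

  column-path′ : ∀ k {c} {r s : Fin n} → k + toℕ r ≡ toℕ s →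
    (c , r) ∈ S → (c , s) ∈ S → Star Step (c , r) (c , s)
  column-path′ zero {r = r} {s} r≡s r∈ _ with refl ← toℕ-injective {i = r} {j = s} r≡s = ε
  column-path′ (suc k) {c} {r} {s} k+1+r≡s r∈ s∈
    with t , r≤t , t+1≡s ← row-below s (≤-trans (s≤s (m≤n+m (toℕ r) k)) (≤-reflexive k+1+r≡s))
    = column-path′ k k+r≡t r∈ t∈ ◅◅ Star.return (t∈ , s∈ , inj₂ (inj₂ (inj₁ (refl , t+1≡s))))
    where
    k+r≡t : k + toℕ r ≡ toℕ t
    k+r≡t = suc-injective (trans k+1+r≡s (sym t+1≡s))
    t∈ : (c , t) ∈ S
    t∈ = ∈-convex r∈ s∈ r≤t (<⇒≤ (≤-reflexive t+1≡s)) ≤-refl ≤-refl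

  column-path : ∀ {c} {r s : Fin n} → (c , r) ∈ S → (c , s) ∈ S → Star Step (c , r) (c , s)
  column-path {r = r} {s} r∈ s∈ with ≤-total (toℕ r) (toℕ s)
  ... | inj₁ r≤s = column-path′ (toℕ s ∸ toℕ r) (m∸n+n≡m r≤s) r∈ s∈
  ... | inj₂ s≤r = Star.reverse Step-sym (column-path′ (toℕ r ∸ toℕ s) (m∸n+n≡m s≤r) s∈ r∈)

  diagonal-path : ∀ {c} {r s : Fin n} → s Fin.≤ r →
    (c , r) ∈ S → (suc c , s) ∈ S → Star Step (c , r) (suc c , s)
  diagonal-path s≤r x∈ y∈ = (x∈ , right∈ , inj₁ (refl , refl)) ◅ column-path right∈ y∈
    where right∈ = ∈-convex y∈ x∈ s≤r ≤-refl (n≤1+n _) ≤-refl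

  weak-link⇒path : ∀ {x y} → Link WeakAdjacent S x y → Star Step x y
  weak-link⇒path (x∈ , y∈ , inj₁ refl)                = column-path x∈ y∈
  weak-link⇒path (x∈ , y∈ , inj₂ (inj₁ (refl , s≤r))) = diagonal-path s≤r x∈ y∈
  weak-link⇒path (x∈ , y∈ , inj₂ (inj₂ (refl , r≤s))) = Star.reverse Step-sym (diagonal-path r≤s y∈ x∈)

  weakly-connected⇒adjacent : Connected WeakAdjacent S → Connected Adjacent S
  weakly-connected⇒adjacent = connected-via weak-link⇒path

  squareFree⇒elbowFree : SquareFree S → ElbowFree S
  squareFree⇒elbowFree squareFree c r s r<s (top-left , top-right , low-right)
    with t , r≤t , t+1≡s ← row-below s r<s
    = squareFree c t s t+1≡s (left∈ , right∈ , top-left , top-right)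
    where
    t≤s : t Fin.≤ s
    t≤s = <⇒≤ (≤-reflexive t+1≡s)
    left∈ : (c , t) ∈ S
    left∈ = ∈-convex low-right top-left r≤t t≤s ≤-refl (n≤1+n c)
    right∈ : (suc c , t) ∈ S
    right∈ = ∈-convex low-right top-left r≤t t≤s (n≤1+n c) ≤-refl

module _ {n : ℕ} (μ : Vec ℕ n) (μ-partition : IsPartition μ) (S : CellSet n) (S⊆ : S ⊆D reverse μ) where

  private
    b-asc : Ascending (reverse μ)
    b-asc = partition⇒reverse-ascending μ μ-partition

  snake⇒rimHook : IsSnake (reverse μ) S → IsRimHook μ S
  snake⇒rimHook (_ , weakly-connected , (a , a≼b , S-skew) , elbowFree) =
      S⊆ , weakly-connected⇒adjacent weakly-connected
    , (reverse a , ascending⇒reverse-partition a a-asc , rev-a≼μ , rev-rev-skew)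
    , elbowFree⇒squareFree elbowFree
    where
    a-asc : Ascending a
    a-asc = ≼K⇒ascending {a = a} {b = reverse μ} b-asc a≼b
    open SkewShape (reverse μ) a S S⊆ S-skew a-asc b-asc
    rev-a≼μ : reverse a ≼Y μ
    rev-a≼μ = subst (reverse a ≼Y_) (reverse-involutive μ) (≼Y-reverse {a = a} {b = reverse μ} (proj₁ a≼b))
    rev-rev-skew : ComplementIs (reverse μ) S (reverse (reverse a))
    rev-rev-skew = subst (ComplementIs (reverse μ) S) (sym (reverse-involutive a)) S-skew

  rimHook⇒snake : IsRimHook μ S → IsSnake (reverse μ) S
  rimHook⇒snake (_ , connected , (λ′ , λ′-partition , λ′≼μ , S-skew) , squareFree) =
      S⊆ , adjacent⇒weakly-connected connected
    , (reverse λ′ , ascending⇒≼K {a = reverse λ′} {b = reverse μ} a-asc (≼Y-reverse {a = λ′} {b = μ} λ′≼μ) , S-skew)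
    , squareFree⇒elbowFree squareFree
    where
    a-asc : Ascending (reverse λ′)
    a-asc = partition⇒reverse-ascending λ′ λ′-partition
    open SkewShape (reverse μ) (reverse λ′) S S⊆ S-skew a-asc b-asc

proposition7p4 : ∀ (n : ℕ) (μ : Vec ℕ n) → IsPartition μ →
    ∀ (S : CellSet n) → S ⊆D reverse μ →
    (IsSnake (reverse μ) S ⇔ IsRimHook μ S)
proposition7p4 n μ μ-partition S S⊆ =
  mk⇔ (snake⇒rimHook μ μ-partition S S⊆) (rimHook⇒snake μ μ-partition S S⊆)
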